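{- If $G$ is a finite simple graph containing no ISK4 and no triangle, and $G$ contains $K_{3,3}$, then either $G$ is a complete bipartite graph or $G$ has a clique cutset of size at most $2$.
   Context: $G$ contains $H$ if $H$ is isomorphic to an induced subgraph of $G$. A subdivision of a graph is obtained by repeatedly replacing an edge $vw$ by a path $vuw$ through a new vertex $u$. An ISK4 is an induced subgraph that is a subdivision of $K_4$. A clique cutset is a clique $C$ such that $G\setminus C$ is disconnected. -}

module Defs where

open import Data.Nat using (ℕ; zero; suc; _≤_; _<?_)
open import Data.Bool using (Bool; true; false; not; _∧_; _∨_; _xor_)
open import Data.Fin using (Fin; zero; suc; toℕ; _≟_)
open import Data.Fin.Subset using (Subset; _∈_; _∉_; ∣_∣)
open import Data.Product using (Σ; ∃; _×_; _,_)
open import Function.Definitions using (Injective)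
open import Relation.Nullary using (¬_; yes; no)
open import Relation.Nullary.Decidable using (⌊_⌋)
open import Relation.Binary.PropositionalEquality using (_≡_; _≢_; refl; sym)

record Graph (n : ℕ) : Set where
  field
    adj    : Fin n → Fin n → Bool
    adj-sym    : ∀ x y → adj x y ≡ adj y x
    adj-irrefl : ∀ x → adj x x ≡ false
open Graph public

_==_ : ∀ {n} → Fin n → Fin n → Bool
x == y = ⌊ x ≟ y ⌋

==-sym : ∀ {n} (x y : Fin n) → (x == y) ≡ (y == x)
==-sym x y with x ≟ y | y ≟ x
... | yes _ | yes _ = refl
... | no _  | no _  = refl
... | yes p | no q  = Data.Empty.⊥-elim (q (sym p)) where import Data.Empty
... | no p  | yes q = Data.Empty.⊥-elim (p (sym q)) where import Data.Empty

==-refl : ∀ {n} (x : Fin n) → (x == x) ≡ true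
==-refl x with x ≟ x
... | yes _ = refl
... | no q  = Data.Empty.⊥-elim (q refl) where import Data.Empty

K : (m : ℕ) → Graph m
K m = record
  { adj = λ x y → not (x == y)
  ; adj-sym = λ x y → cong′ (==-sym x y)
  ; adj-irrefl = λ x → cong′ (==-refl x)
  }
  where
  cong′ : ∀ {a b : Bool} → a ≡ b → not a ≡ not b
  cong′ refl = refl

xor-comm : ∀ a b → (a xor b) ≡ (b xor a)
xor-comm false false = refl
xor-comm false true  = refl
xor-comm true  false = refl
xor-comm true  true  = refl

xor-self : ∀ a → (a xor a) ≡ false
xor-self false = refl
xor-self true  = refl

-- The complete bipartite graph K_{3,3}: vertices 0,1,2 on one side,
-- 3,4,5 on the other.
K33 : Graph 6
K33 = record
  { adj = λ x y → side x xor side y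
  ; adj-sym = λ x y → xor-comm (side x) (side y)
  ; adj-irrefl = λ x → xor-self (side x)
  }
  where
  side : Fin 6 → Bool
  side x = ⌊ toℕ x <? 3 ⌋

Contains : ∀ {n m} → Graph n → Graph m → Set
Contains {n} {m} G H =
  Σ (Fin m → Fin n) λ f → Injective _≡_ _≡_ f × (∀ x y → adj H x y ≡ adj G (f x) (f y))

-- H (on Fin (suc m)) is obtained from G (on Fin m) by replacing the edge vw
-- by a path v u w through a new vertex u; u is vertex zero of H and each old
-- vertex x of G is vertex suc x of H.
SubdividedAt : ∀ {m} → Graph m → Fin m → Fin m → Graph (suc m) → Set
SubdividedAt G v w H =
  (∀ x y → adj H (suc x) (suc y)
             ≡ (adj G x y ∧ not ((x == v ∧ y == w) ∨ (x == w ∧ y == v))))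
  × (∀ y → adj H zero (suc y) ≡ (y == v ∨ y == w))

-- Graphs that are subdivisions of K_4 (obtained from K_4 by repeatedly
-- subdividing edges), up to the vertex labelling fixed above; isomorphism
-- is absorbed by 'Contains'.
data SubdivK4 : ∀ {m} → Graph m → Set where
  base : ∀ {H : Graph 4} → (∀ x y → adj H x y ≡ adj (K 4) x y) → SubdivK4 H
  step : ∀ {m} {G : Graph m} {H : Graph (suc m)} (v w : Fin m) →
         adj G v w ≡ true → SubdivK4 G → SubdividedAt G v w H → SubdivK4 H

HasISK4 : ∀ {n} → Graph n → Set
HasISK4 G = Σ ℕ λ m → Σ (Graph m) λ H → SubdivK4 H × Contains G H

IsCompleteBipartite : ∀ {n} → Graph n → Set
IsCompleteBipartite {n} G =
  Σ (Fin n → Bool) λ side → ∀ x y → adj G x y ≡ (side x xor side y)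

data ReachAvoid {n} (G : Graph n) (C : Subset n) : Fin n → Fin n → Set where
  here : ∀ {a} → a ∉ C → ReachAvoid G C a a
  next : ∀ {a b c} → a ∉ C → adj G a b ≡ true → ReachAvoid G C b c → ReachAvoid G C a c

IsClique : ∀ {n} → Graph n → Subset n → Set
IsClique G C = ∀ x y → x ∈ C → y ∈ C → x ≢ y → adj G x y ≡ true

Disconnects : ∀ {n} → Graph n → Subset n → Set
Disconnects G C = Σ _ λ a → Σ _ λ b → a ∉ C × b ∉ C × ¬ ReachAvoid G C a b

HasCliqueCutset≤2 : ∀ {n} → Graph n → Set
HasCliqueCutset≤2 {n} G =
  Σ (Subset n) λ C → IsClique G C × Disconnects G C × ∣ C ∣ ≤ 2

-- Call a vertex on side σ if it sees the three corners of the other side of the K₃,₃. By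
-- triangle-freeness the two sides are disjoint stable sets, and by ISK4-freeness every vertex of
-- one side sees every vertex of the other. The key fact is that no walk whose inner vertices lie on
-- neither side joins two vertices of the same side: a shortest one is an induced path, and with a
-- third vertex of its side and two vertices of the other side that miss its interior it induces a
-- subdivision of K₄. So if every vertex is on a side, G is complete bipartite. Otherwise take the
-- component R of the remaining vertices around one of them: it has at most one neighbour on each
-- side, and these neighbours form a clique cutset separating R from a corner of the K₃,₃.

module Submission where

open import Defs
open import Data.Bool using (Bool; true; false; not; _∧_; _∨_; _xor_)
open import Data.Bool.Properties using (∨-identityʳ; ∧-identityʳ; ∧-zeroʳ; ∨-comm; ∧-comm; not-involutive)
import Data.Bool.Properties as Boolₚ
open import Data.Empty using (⊥; ⊥-elim)
open import Data.Fin using (Fin; zero; suc; _≟_; _↑ˡ_; _↑ʳ_)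
open import Data.Fin.Patterns using (0F; 1F; 2F; 3F; 4F)
open import Data.Fin.Properties using (all?; any?; ¬∀⟶∃¬; ↑ˡ-injective; ↑ʳ-injective; 0≢1+n; suc-injective)
open import Data.Fin.Subset using (Subset; ⁅_⁆; _∪_; ∣_∣; _⊆_; inside; outside)
  renaming (_∈_ to _∈ₛ_; _∉_ to _∉ₛ_)
open import Data.Fin.Subset.Properties
  using (_∈?_; ∣p∣≤n; x∈p∪q⁻; x∈p∪q⁺; p⊆p∪q; x∈⁅x⁆; x∈⁅y⁆⇒x≡y; p⊂q⇒∣p∣<∣q∣; Empty-unique; ∣⊥∣≡0)
open import Data.List using (List; []; _∷_; _++_; length; lookup; drop)
open import Data.List.Properties using (length-++; ++-assoc)
open import Data.List.Membership.Propositional using (_∈_; find)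
open import Data.List.Membership.Propositional.Properties using (∈-++⁺ˡ; ∈-++⁺ʳ; ∈-++⁻; ∈-∃++; ∈-lookup)
open import Data.List.Relation.Unary.All as All using (All; []; _∷_)
import Data.List.Relation.Unary.All.Properties as Allₚ
open import Data.List.Relation.Unary.Any as Any using (here; there)
open import Data.List.Relation.Unary.Any.Properties using (lookup-index)
open import Data.List.Relation.Unary.AllPairs using ([]; _∷_)
open import Data.List.Relation.Unary.Unique.Propositional using (Unique)
import Data.List.Relation.Unary.Unique.Propositional.Properties as Uniqueₚ
open import Data.Nat using (ℕ; zero; suc; _≤_; _<_; _+_; z≤n; s≤s)
open import Data.Nat.Properties
  using (≤-trans; ≤-reflexive; <-≤-trans; ≤-<-trans; <-trans; <-irrefl; ≤-pred; n<1+n; n≤1+n; m≤m+n; m≤n+m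
        ; +-suc; +-mono-≤; +-monoʳ-<; +-monoʳ-≤)
open import Data.Product using (∃; ∃₂; _×_; _,_; proj₁; proj₂)
open import Data.Sum using (_⊎_; inj₁; inj₂; [_,_]′)
open import Data.Unit using (⊤; tt)
open import Data.Vec using ([]; _∷_; tabulate; here; there)
open import Data.Vec.Properties using (lookup∘tabulate; []=⇒lookup; lookup⇒[]=)
open import Function using (_∘_; id)
open import Function.Definitions using (Injective)
open import Relation.Nullary using (¬_; Dec; yes; no; does)
open import Relation.Nullary.Decidable
  using (map′; ¬?; _×-dec_; dec-true; dec-false; decidable-stable; toWitness)
open import Relation.Unary using (Pred; Decidable)
open import Relation.Binary.PropositionalEquality
  using (_≡_; _≢_; refl; sym; trans; cong; cong₂; subst; module ≡-Reasoning)

∨-true⁻ : ∀ {a b} → a ∨ b ≡ true → a ≡ true ⊎ b ≡ true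
∨-true⁻ {true}  _ = inj₁ refl
∨-true⁻ {false} p = inj₂ p

∨-trueˡ : ∀ {a} b → a ≡ true → a ∨ b ≡ true
∨-trueˡ _ refl = refl

∨-trueʳ : ∀ a {b} → b ≡ true → a ∨ b ≡ true
∨-trueʳ true  _ = refl
∨-trueʳ false p = p

∧-true⁻ : ∀ {a b} → a ∧ b ≡ true → a ≡ true × b ≡ true
∧-true⁻ {true} p = refl , p

≢true⇒≡false : ∀ {a} → a ≢ true → a ≡ false
≢true⇒≡false {true}  p = ⊥-elim (p refl)
≢true⇒≡false {false} _ = refl

≡false⇒≢true : ∀ {a} → a ≡ false → a ≢ true
≡false⇒≢true refl ()

Bool-ext : ∀ {a b} → (a ≡ true → b ≡ true) → (b ≡ true → a ≡ true) → a ≡ b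
Bool-ext {true}          f _ = sym (f refl)
Bool-ext {false} {true}  _ g = g refl
Bool-ext {false} {false} _ _ = refl

==⇒≡ : ∀ {n} {x y : Fin n} → (x == y) ≡ true → x ≡ y
==⇒≡ {x = x} {y} p with x ≟ y
... | yes x≡y = x≡y
==⇒≡ () | no _

≡⇒== : ∀ {n} {x y : Fin n} → x ≡ y → (x == y) ≡ true
≡⇒== {x = x} refl = ==-refl x

≢⇒==false : ∀ {n} {x y : Fin n} → x ≢ y → (x == y) ≡ false
≢⇒==false x≢y = ≢true⇒≡false (x≢y ∘ ==⇒≡)

==-injective : ∀ {m n} {f : Fin m → Fin n} → Injective _≡_ _≡_ f → ∀ i j → (f i == f j) ≡ (i == j)
==-injective {f = f} f-inj i j = Bool-ext (≡⇒== ∘ f-inj ∘ ==⇒≡) (≡⇒== ∘ cong f ∘ ==⇒≡)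

headOr : ∀ {A : Set} → List A → A → A
headOr []      b = b
headOr (x ∷ _) _ = x

lookup-injective : ∀ {A : Set} {xs : List A} → Unique xs → Injective _≡_ _≡_ (lookup xs)
lookup-injective {xs = _ ∷ _}  _              {zero}  {zero}  _ = refl
lookup-injective {xs = _ ∷ xs} (x∉xs ∷ _)     {zero}  {suc j} e = ⊥-elim (All.lookup x∉xs (∈-lookup j) e)
lookup-injective {xs = _ ∷ xs} (x∉xs ∷ _)     {suc i} {zero}  e = ⊥-elim (All.lookup x∉xs (∈-lookup i) (sym e))
lookup-injective {xs = _ ∷ xs} (_ ∷ xs-unique) {suc i} {suc j} e = cong suc (lookup-injective xs-unique e)

length-++-< : ∀ {A : Set} (xs : List A) {ys zs : List A} →
              length ys < length zs → length (xs ++ ys) < length (xs ++ zs)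
length-++-< xs {ys} {zs} lt rewrite length-++ xs {ys} | length-++ xs {zs} = +-monoʳ-< (length xs) lt

length-<-∷-++ : ∀ {A : Set} (x : A) xs ys → length ys < length (x ∷ xs ++ ys)
length-<-∷-++ x xs ys rewrite length-++ xs {ys} = s≤s (m≤n+m (length ys) (length xs))

All-upto : ∀ {A : Set} {P : A → Set} xs {x ys} → All P (xs ++ x ∷ ys) → All P (xs ++ x ∷ [])
All-upto xs p = Allₚ.++⁺ (Allₚ.++⁻ˡ xs p) (All.head (Allₚ.++⁻ʳ xs p) ∷ [])

All-skip : ∀ {A : Set} {P : A → Set} xs {x} ys {zs} → All P (xs ++ x ∷ ys ++ zs) → All P (xs ++ x ∷ zs)
All-skip xs ys p = Allₚ.++⁺ (Allₚ.++⁻ˡ xs p) (All.head rest ∷ Allₚ.++⁻ʳ ys (All.tail rest))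
  where rest = Allₚ.++⁻ʳ xs p

All-delete : ∀ {A : Set} {P : A → Set} xs ys {zs} → All P (xs ++ ys ++ zs) → All P (xs ++ zs)
All-delete xs ys p = Allₚ.++⁺ (Allₚ.++⁻ˡ xs p) (Allₚ.++⁻ʳ ys (Allₚ.++⁻ʳ xs p))

All-headOr : ∀ {A : Set} {P : A → Set} xs {b} → All P (xs ++ b ∷ []) → P (headOr xs b)
All-headOr []      = All.head
All-headOr (_ ∷ _) = All.head

subset : ∀ {n p} {P : Pred (Fin n) p} → Decidable P → Subset n
subset P? = tabulate (does ∘ P?)

∈-subset⁺ : ∀ {n p} {P : Pred (Fin n) p} (P? : Decidable P) {x} → P x → x ∈ₛ subset P?
∈-subset⁺ P? {x} px = lookup⇒[]= x _ (trans (lookup∘tabulate _ x) (dec-true (P? x) px))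

∈-subset⁻ : ∀ {n p} {P : Pred (Fin n) p} (P? : Decidable P) {x} → x ∈ₛ subset P? → P x
∈-subset⁻ P? {x} x∈ = decidable-stable (P? x) λ ¬px →
  ≡false⇒≢true (trans (sym ([]=⇒lookup x∈)) (trans (lookup∘tabulate _ x) (dec-false (P? x) ¬px))) refl

∣p∪q∣≤∣p∣+∣q∣ : ∀ {n} (p q : Subset n) → ∣ p ∪ q ∣ ≤ ∣ p ∣ + ∣ q ∣
∣p∪q∣≤∣p∣+∣q∣ []            []            = z≤n
∣p∪q∣≤∣p∣+∣q∣ (outside ∷ p) (outside ∷ q) = ∣p∪q∣≤∣p∣+∣q∣ p q
∣p∪q∣≤∣p∣+∣q∣ (outside ∷ p) (inside ∷ q)  =
  ≤-trans (s≤s (∣p∪q∣≤∣p∣+∣q∣ p q)) (≤-reflexive (sym (+-suc ∣ p ∣ ∣ q ∣)))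
∣p∪q∣≤∣p∣+∣q∣ (inside ∷ p)  (outside ∷ q) = s≤s (∣p∪q∣≤∣p∣+∣q∣ p q)
∣p∪q∣≤∣p∣+∣q∣ (inside ∷ p)  (inside ∷ q)  =
  s≤s (≤-trans (∣p∪q∣≤∣p∣+∣q∣ p q) (+-monoʳ-≤ ∣ p ∣ (n≤1+n ∣ q ∣)))

∣p∣<∣p∪⁅x⁆∣ : ∀ {n} {p : Subset n} {x} → x ∉ₛ p → ∣ p ∣ < ∣ p ∪ ⁅ x ⁆ ∣
∣p∣<∣p∪⁅x⁆∣ {p = p} {x} x∉p = p⊂q⇒∣p∣<∣q∣ (p⊆p∪q ⁅ x ⁆ , x , x∈p∪q⁺ (inj₂ (x∈⁅x⁆ x)) , x∉p)

∣p∣≤1 : ∀ {n} (p : Subset n) → (∀ {x y} → x ∈ₛ p → y ∈ₛ p → x ≡ y) → ∣ p ∣ ≤ 1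
∣p∣≤1 []            _ = z≤n
∣p∣≤1 (outside ∷ p) h = ∣p∣≤1 p λ x∈p y∈p → suc-injective (h (there x∈p) (there y∈p))
∣p∣≤1 {suc n} (inside ∷ p)  h = s≤s (≤-reflexive (trans (cong ∣_∣ (Empty-unique empty)) (∣⊥∣≡0 n)))
  where
  empty : ¬ ∃ λ x → x ∈ₛ p
  empty (x , x∈p) = 0≢1+n (h here (there x∈p))

two-missing : ∀ {p} {P : Pred (Fin 3) p} → Decidable P → (∀ {i j} → P i → P j → i ≡ j) →
              ∃₂ λ i j → i ≢ j × ¬ P i × ¬ P j
two-missing P? unique with P? 0F | P? 1F
... | yes p₀ | _     = 1F , 2F , (λ ()) , (λ p₁ → 0≢1+n (unique p₀ p₁)) , (λ p₂ → 0≢1+n (unique p₀ p₂))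
... | no ¬p₀ | yes p₁ = 0F , 2F , (λ ()) , ¬p₀ , (λ p₂ → 0≢1+n (suc-injective (unique p₁ p₂)))
... | no ¬p₀ | no ¬p₁ = 0F , 1F , (λ ()) , ¬p₀ , ¬p₁

induced : ∀ {m n} → Graph n → (Fin m → Fin n) → Graph m
induced G f = record
  { adj        = λ i j → adj G (f i) (f j)
  ; adj-sym    = λ i j → adj-sym G (f i) (f j)
  ; adj-irrefl = λ i → adj-irrefl G (f i)
  }

-- The Boolean by which SubdividedAt deletes the edge uz.
link : ∀ {n} → Fin n → Fin n → Fin n → Fin n → Bool
link u z a b = (a == u ∧ b == z) ∨ (a == z ∧ b == u)

Link : ∀ {n} → Fin n → Fin n → Fin n → Fin n → Set
Link u z a b = (a ≡ u × b ≡ z) ⊎ (a ≡ z × b ≡ u)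

link⁻ : ∀ {n} {u z a b : Fin n} → link u z a b ≡ true → Link u z a b
link⁻ p with ∨-true⁻ p
... | inj₁ q = let (a≡u , b≡z) = ∧-true⁻ q in inj₁ (==⇒≡ a≡u , ==⇒≡ b≡z)
... | inj₂ q = let (a≡z , b≡u) = ∧-true⁻ q in inj₂ (==⇒≡ a≡z , ==⇒≡ b≡u)

link-sym : ∀ {n} (u z a b : Fin n) → link u z a b ≡ link u z b a
link-sym u z a b = trans (∨-comm (a == u ∧ b == z) _) (cong₂ _∨_ (∧-comm (a == z) _) (∧-comm (a == u) _))

link-avoiding : ∀ {n} {u x a b : Fin n} → a ≢ x → b ≢ x → link u x a b ≡ false
link-avoiding {u = u} {a = a} a≢x b≢x rewrite ≢⇒==false a≢x | ≢⇒==false b≢x =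
  trans (∨-identityʳ _) (∧-zeroʳ (a == u))

link-injective : ∀ {m n} {f : Fin m → Fin n} → Injective _≡_ _≡_ f →
                 ∀ p q i j → link (f p) (f q) (f i) (f j) ≡ link p q i j
link-injective f-inj p q i j
  rewrite ==-injective f-inj i p | ==-injective f-inj j q
        | ==-injective f-inj i q | ==-injective f-inj j p = refl

withEdge : ∀ {n} → Graph n → Fin n → Fin n → Graph n
withEdge G u z = record
  { adj        = λ a b → adj G a b ∨ (link u z a b ∧ not (a == b))
  ; adj-sym    = λ a b → cong₂ _∨_ (adj-sym G a b) (cong₂ (λ l e → l ∧ not e) (link-sym u z a b) (==-sym a b))
  ; adj-irrefl = λ a → trans (cong₂ (λ e r → e ∨ (link u z a a ∧ not r)) (adj-irrefl G a) (==-refl a))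
                             (∧-zeroʳ (link u z a a))
  }

side : Bool → Fin 3 → Fin 6
side true  i = i ↑ˡ 3
side false i = 3 ↑ʳ i

side-injective : ∀ σ → Injective _≡_ _≡_ (side σ)
side-injective true  = ↑ˡ-injective 3 _ _
side-injective false = ↑ʳ-injective 3 _ _

K33-across : ∀ σ i j → adj K33 (side σ i) (side (not σ) j) ≡ true
K33-across true  = toWitness {a? = all? λ i → all? λ j → adj K33 (side true i) (side false j) Boolₚ.≟ true} _
K33-across false = toWitness {a? = all? λ i → all? λ j → adj K33 (side false i) (side true j) Boolₚ.≟ true} _

K33-within : ∀ σ i j → adj K33 (side σ i) (side σ j) ≡ false
K33-within true  = toWitness {a? = all? λ i → all? λ j → adj K33 (side true i) (side true j) Boolₚ.≟ false} _
K33-within false = toWitness {a? = all? λ i → all? λ j → adj K33 (side false i) (side false j) Boolₚ.≟ false} _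

module Adjacency {n} (G : Graph n) where

  infix 4 _~_
  _~_ : Fin n → Fin n → Set
  x ~ y = adj G x y ≡ true

  _~?_ : ∀ x y → Dec (x ~ y)
  x ~? y = adj G x y Boolₚ.≟ true

  ~-sym : ∀ {x y} → x ~ y → y ~ x
  ~-sym {x} {y} = trans (adj-sym G y x)

  ~⇒≢ : ∀ {x y} → x ~ y → x ≢ y
  ~⇒≢ {x} x~x refl = ≡false⇒≢true (adj-irrefl G x) x~x

  K-embedding-injective : ∀ {m} (g : Fin m → Fin n) → (∀ i j → adj (K m) i j ≡ adj G (g i) (g j)) →
                          Injective _≡_ _≡_ g
  K-embedding-injective g g-adj {i} {j} gi≡gj with i ≟ j
  ... | yes i≡j = i≡j
  ... | no i≢j  = ⊥-elim (≡false⇒≢true gi≁gj (trans (sym (g-adj i j)) (cong not (≢⇒==false i≢j))))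
    where
    gi≁gj : adj G (g i) (g j) ≡ false
    gi≁gj = trans (cong (adj G (g i)) (sym gi≡gj)) (adj-irrefl G (g i))

  no-triangle : ¬ Contains G (K 3) → ∀ {x y z} → x ~ y → y ~ z → x ~ z → ⊥
  no-triangle noK₃ {x} {y} {z} x~y y~z x~z = noK₃ (g , K-embedding-injective g g-adj , g-adj)
    where
    g : Fin 3 → Fin n
    g 0F = x
    g 1F = y
    g 2F = z
    g-adj : ∀ i j → adj (K 3) i j ≡ adj G (g i) (g j)
    g-adj 0F 0F = sym (adj-irrefl G x)
    g-adj 0F 1F = sym x~y
    g-adj 0F 2F = sym x~z
    g-adj 1F 0F = sym (~-sym x~y)
    g-adj 1F 1F = sym (adj-irrefl G y)
    g-adj 1F 2F = sym y~z
    g-adj 2F 0F = sym (~-sym x~z)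
    g-adj 2F 1F = sym (~-sym y~z)
    g-adj 2F 2F = sym (adj-irrefl G z)

  Walk : Fin n → List (Fin n) → Fin n → Set
  Walk a []       b = a ~ b
  Walk a (x ∷ xs) b = a ~ x × Walk x xs b

  walk-head : ∀ {a b} xs → Walk a xs b → a ~ headOr xs b
  walk-head []      a~b       = a~b
  walk-head (_ ∷ _) (a~x , _) = a~x

  walk-split : ∀ {a b y} xs ys → Walk a (xs ++ y ∷ ys) b → Walk a xs y × Walk y ys b
  walk-split []       _  (a~y , w) = a~y , w
  walk-split (_ ∷ xs) ys (a~x , w) = let (w₁ , w₂) = walk-split xs ys w in (a~x , w₁) , w₂

  walk-join : ∀ {a b y} xs ys → Walk a xs y → Walk y ys b → Walk a (xs ++ y ∷ ys) b
  walk-join []       _  a~y       w₂ = a~y , w₂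
  walk-join (_ ∷ xs) ys (a~x , w₁) w₂ = a~x , walk-join xs ys w₁ w₂

  Chordless : List (Fin n) → Set
  Chordless []       = ⊤
  Chordless (x ∷ xs) = All (λ y → ¬ x ~ y) (drop 1 xs) × Chordless xs

module Subdivision {n} (G : Graph n) where

  open Adjacency G

  withEdge⁻ : ∀ {u z a b} → adj (withEdge G u z) a b ≡ true → a ~ b ⊎ Link u z a b
  withEdge⁻ p with ∨-true⁻ p
  ... | inj₁ a~b = inj₁ a~b
  ... | inj₂ q   = inj₂ (link⁻ (proj₁ (∧-true⁻ q)))

  withEdge⁺ˡ : ∀ {u z a b} → a ~ b → adj (withEdge G u z) a b ≡ true
  withEdge⁺ˡ = ∨-trueˡ _

  withEdge⁺ʳ : ∀ {u z a b} → a ≢ b → Link u z a b → adj (withEdge G u z) a b ≡ true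
  withEdge⁺ʳ {u} {z} {a} {b} a≢b l = ∨-trueʳ (adj G a b) (cong₂ _∧_ (linked l) (cong not (≢⇒==false a≢b)))
    where
    linked : Link u z a b → link u z a b ≡ true
    linked (inj₁ (refl , refl)) = ∨-trueˡ _ (cong₂ _∧_ (==-refl a) (==-refl b))
    linked (inj₂ (refl , refl)) = ∨-trueʳ (a == u ∧ b == a) (cong₂ _∧_ (==-refl a) (==-refl b))

  withEdge-unlinked : ∀ {u z a b} → link u z a b ≡ false → adj (withEdge G u z) a b ≡ adj G a b
  withEdge-unlinked {a = a} {b} unlinked rewrite unlinked = ∨-identityʳ (adj G a b)

  withEdge-present : ∀ {u z} → u ~ z → ∀ a b → adj (withEdge G u z) a b ≡ adj G a b
  withEdge-present {u} {z} u~z a b = Bool-ext to withEdge⁺ˡ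
    where
    to : adj (withEdge G u z) a b ≡ true → a ~ b
    to p with withEdge⁻ p
    ... | inj₁ a~b                = a~b
    ... | inj₂ (inj₁ (refl , refl)) = u~z
    ... | inj₂ (inj₂ (refl , refl)) = ~-sym u~z

  withEdge-deleted : ∀ {u z} → ¬ u ~ z → ∀ a b → adj (withEdge G u z) a b ∧ not (link u z a b) ≡ adj G a b
  withEdge-deleted {u} {z} u≁z a b with link u z a b in linked
  ... | false = trans (∧-identityʳ _) (∨-identityʳ (adj G a b))
  ... | true  = trans (∧-zeroʳ _) (sym (≢true⇒≡false (a≁b (link⁻ linked))))
    where
    a≁b : Link u z a b → ¬ a ~ b
    a≁b (inj₁ (refl , refl)) = u≁z
    a≁b (inj₂ (refl , refl)) = u≁z ∘ ~-sym

  -- The new vertex x = W zero subdivides the artificial edge uz of the smaller graph into ux and xz.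
  subdivide-step : ∀ {m} (W : Fin (suc m) → Fin n) → Injective _≡_ _≡_ W → ∀ {u z} (pu pz : Fin m) →
                   W (suc pu) ≡ u → W (suc pz) ≡ z → u ≢ z → ¬ u ~ z → W zero ~ z →
                   (∀ j → W (suc j) ≡ u ⊎ W (suc j) ≡ z ⊎ ¬ W zero ~ W (suc j)) →
                   SubdivK4 (induced (withEdge G u z) (W ∘ suc)) →
                   SubdivK4 (induced (withEdge G u (W zero)) W)
  subdivide-step W W-inj pu pz refl refl u≢z u≁z x~z neighbours K =
    step pu pz (withEdge⁺ʳ u≢z (inj₁ (refl , refl))) K (old-pairs , new-vertex)
    where
    open ≡-Reasoning
    x = W zero
    u = W (suc pu)
    z = W (suc pz)

    x≢ : ∀ j → x ≢ W (suc j)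
    x≢ j = 0≢1+n ∘ W-inj

    W-suc-inj : Injective _≡_ _≡_ (W ∘ suc)
    W-suc-inj = suc-injective ∘ W-inj

    old-pairs : ∀ i j → adj (withEdge G u x) (W (suc i)) (W (suc j))
                        ≡ adj (withEdge G u z) (W (suc i)) (W (suc j)) ∧ not (link pu pz i j)
    old-pairs i j = begin
      adj (withEdge G u x) a b
        ≡⟨ withEdge-unlinked (link-avoiding (x≢ i ∘ sym) (x≢ j ∘ sym)) ⟩
      adj G a b
        ≡⟨ sym (withEdge-deleted u≁z a b) ⟩
      adj (withEdge G u z) a b ∧ not (link u z a b)
        ≡⟨ cong (λ l → adj (withEdge G u z) a b ∧ not l) (link-injective W-suc-inj pu pz i j) ⟩
      adj (withEdge G u z) a b ∧ not (link pu pz i j) ∎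
      where
      a = W (suc i)
      b = W (suc j)

    new-vertex : ∀ j → adj (withEdge G u x) x (W (suc j)) ≡ (j == pu ∨ j == pz)
    new-vertex j =
      trans (Bool-ext to from) (cong₂ _∨_ (==-injective W-suc-inj j pu) (==-injective W-suc-inj j pz))
      where
      b = W (suc j)
      to : adj (withEdge G u x) x b ≡ true → (b == u ∨ b == z) ≡ true
      to p with withEdge⁻ p | neighbours j
      ... | inj₁ _            | inj₁ b≡u        = ∨-trueˡ _ (≡⇒== b≡u)
      ... | inj₁ _            | inj₂ (inj₁ b≡z) = ∨-trueʳ _ (≡⇒== b≡z)
      ... | inj₁ x~b          | inj₂ (inj₂ x≁b) = ⊥-elim (x≁b x~b)
      ... | inj₂ (inj₁ (_ , b≡x)) | _           = ⊥-elim (x≢ j (sym b≡x))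
      ... | inj₂ (inj₂ (_ , b≡u)) | _           = ∨-trueˡ _ (≡⇒== b≡u)
      from : (b == u ∨ b == z) ≡ true → adj (withEdge G u x) x b ≡ true
      from q with ∨-true⁻ q
      ... | inj₁ b==u = withEdge⁺ʳ (x≢ j) (inj₂ (refl , ==⇒≡ b==u))
      ... | inj₂ b==z = withEdge⁺ˡ (subst (x ~_) (sym (==⇒≡ b==z)) x~z)

  -- a, u, v, b₁, b₂ span K₂,₃ with parts {a, u, v} and {b₁, b₂}, except that uv may be an edge.
  record Frame (a u v b₁ b₂ : Fin n) : Set where
    field
      u~b₁  : u ~ b₁
      u~b₂  : u ~ b₂
      v~b₁  : v ~ b₁
      v~b₂  : v ~ b₂
      a~b₁  : a ~ b₁
      a~b₂  : a ~ b₂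
      a≁u   : ¬ a ~ u
      a≁v   : ¬ a ~ v
      b₁≁b₂ : ¬ b₁ ~ b₂

  module FramedPath {a u v b₁ b₂} (frame : Frame a u v b₁ b₂) where

    open Frame frame

    T : List (Fin n)
    T = a ∷ u ∷ v ∷ b₁ ∷ b₂ ∷ []

    Avoids : Fin n → Set
    Avoids x = ¬ x ~ a × ¬ x ~ b₁ × ¬ x ~ b₂

    -- K₄ on u, v, b₁, b₂ (with uv added), in which a subdivides b₁b₂.
    base-stage : Unique T → SubdivK4 (induced (withEdge G u v) (lookup T))
    base-stage ((a≢u ∷ a≢v ∷ _) ∷ (u≢v ∷ u≢b₁ ∷ u≢b₂ ∷ []) ∷ (v≢b₁ ∷ v≢b₂ ∷ []) ∷ _) =
      step 2F 3F refl (base {H = K 4} λ _ _ → refl) (old-pairs , new-vertex)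
      where
      H = induced (withEdge G u v) (lookup T)
      non-edge : ∀ {c d} → ¬ c ~ d → ¬ Link u v c d → adj (withEdge G u v) c d ≡ false
      non-edge c≁d unlinked = ≢true⇒≡false λ p → [ c≁d , unlinked ]′ (withEdge⁻ p)
      a-unlinked : ∀ {d} → ¬ Link u v a d
      a-unlinked (inj₁ (a≡u , _)) = a≢u a≡u
      a-unlinked (inj₂ (a≡v , _)) = a≢v a≡v
      b-unlinked : ∀ {b d} → u ≢ b → v ≢ b → ¬ Link u v b d
      b-unlinked u≢b _   (inj₁ (b≡u , _)) = u≢b (sym b≡u)
      b-unlinked _   v≢b (inj₂ (b≡v , _)) = v≢b (sym b≡v)
      old-pairs : ∀ i j → adj H (suc i) (suc j) ≡ adj (K 4) i j ∧ not (link 2F 3F i j)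
      old-pairs 0F 0F = adj-irrefl H 1F
      old-pairs 0F 1F = withEdge⁺ʳ u≢v (inj₁ (refl , refl))
      old-pairs 0F 2F = withEdge⁺ˡ u~b₁
      old-pairs 0F 3F = withEdge⁺ˡ u~b₂
      old-pairs 1F 0F = withEdge⁺ʳ (u≢v ∘ sym) (inj₂ (refl , refl))
      old-pairs 1F 1F = adj-irrefl H 2F
      old-pairs 1F 2F = withEdge⁺ˡ v~b₁
      old-pairs 1F 3F = withEdge⁺ˡ v~b₂
      old-pairs 2F 0F = withEdge⁺ˡ (~-sym u~b₁)
      old-pairs 2F 1F = withEdge⁺ˡ (~-sym v~b₁)
      old-pairs 2F 2F = adj-irrefl H 3F
      old-pairs 2F 3F = non-edge b₁≁b₂ (b-unlinked u≢b₁ v≢b₁)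
      old-pairs 3F 0F = withEdge⁺ˡ (~-sym u~b₂)
      old-pairs 3F 1F = withEdge⁺ˡ (~-sym v~b₂)
      old-pairs 3F 2F = non-edge (b₁≁b₂ ∘ ~-sym) (b-unlinked u≢b₂ v≢b₂)
      old-pairs 3F 3F = adj-irrefl H 4F
      new-vertex : ∀ j → adj H 0F (suc j) ≡ (j == 2F ∨ j == 3F)
      new-vertex 0F = non-edge a≁u a-unlinked
      new-vertex 1F = non-edge a≁v a-unlinked
      new-vertex 2F = withEdge⁺ˡ a~b₁
      new-vertex 3F = withEdge⁺ˡ a~b₂

    u∈ : ∀ s → u ∈ s ++ T
    u∈ s = ∈-++⁺ʳ s (there (here refl))

    headOr∈ : ∀ s → headOr s v ∈ s ++ T
    headOr∈ []      = there (there (here refl))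
    headOr∈ (_ ∷ _) = here refl

    u≢headOr : ∀ s → Unique (s ++ T) → u ≢ headOr s v
    u≢headOr []      (_ ∷ (u≢v ∷ _) ∷ _) = u≢v
    u≢headOr (_ ∷ s) (y∉ ∷ _)            = All.lookup y∉ (u∈ s) ∘ sym

    T-neighbours : ∀ {x y} → Avoids x → y ∈ T → y ≡ u ⊎ y ≡ v ⊎ ¬ x ~ y
    T-neighbours (x≁a , _ , _)  (here refl)                                 = inj₂ (inj₂ x≁a)
    T-neighbours _              (there (here refl))                         = inj₁ refl
    T-neighbours _              (there (there (here refl)))                 = inj₂ (inj₁ refl)
    T-neighbours (_ , x≁b₁ , _) (there (there (there (here refl))))         = inj₂ (inj₂ x≁b₁)
    T-neighbours (_ , _ , x≁b₂) (there (there (there (there (here refl))))) = inj₂ (inj₂ x≁b₂)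

    neighbours-within : ∀ {x} s → All (λ y → ¬ x ~ y) (drop 1 (s ++ v ∷ [])) → Avoids x →
                        ∀ {y} → y ∈ s ++ T → y ≡ u ⊎ y ≡ headOr s v ⊎ ¬ x ~ y
    neighbours-within []      _   avoids y∈T         = T-neighbours avoids y∈T
    neighbours-within (_ ∷ s) _   _      (here refl) = inj₂ (inj₁ refl)
    neighbours-within (_ ∷ s) far avoids (there y∈) with ∈-++⁻ s y∈
    ... | inj₁ y∈s = inj₂ (inj₂ (All.lookup far (∈-++⁺ˡ y∈s)))
    ... | inj₂ y∈T with T-neighbours avoids y∈T
    ...   | inj₁ y≡u          = inj₁ y≡u
    ...   | inj₂ (inj₁ refl)  = inj₂ (inj₂ (All.lookup far (∈-++⁺ʳ s (here refl))))
    ...   | inj₂ (inj₂ x≁y)   = inj₂ (inj₂ x≁y)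

    -- In the stage of a suffix s of the path, the artificial edge from u to the head of s ++ v ∷ []
    -- stands for the part of the path not yet added.
    stage : ∀ {c} s → Walk c s v → Chordless (s ++ v ∷ []) → All (λ y → ¬ u ~ y) (drop 1 (s ++ v ∷ [])) →
            Unique (s ++ T) → All Avoids s → SubdivK4 (induced (withEdge G u (headOr s v)) (lookup (s ++ T)))
    stage []      _          _                   _     unique _                  = base-stage unique
    stage (x ∷ s) (_ , walk) (x-far , chordless) u-far (x∉ ∷ unique) (x-avoids ∷ avoids) =
      subdivide-step (lookup (x ∷ s ++ T)) (lookup-injective (x∉ ∷ unique))
        (Any.index (u∈ s)) (Any.index (headOr∈ s)) (sym (lookup-index (u∈ s))) (sym (lookup-index (headOr∈ s)))
        (u≢headOr s unique) (All-headOr s u-far) (walk-head s walk)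
        (λ j → neighbours-within s x-far x-avoids (∈-lookup {xs = s ++ T} j))
        (stage s walk chordless (Allₚ.drop⁺ 1 u-far) unique avoids)

    isk4 : ∀ xs → Walk u xs v → Chordless (u ∷ xs ++ v ∷ []) → Unique (xs ++ T) → All Avoids xs → HasISK4 G
    isk4 xs walk (u-far , chordless) unique avoids =
      _ , _ , stage xs walk chordless u-far unique avoids ,
      lookup (xs ++ T) , lookup-injective unique , λ _ _ → withEdge-present (walk-head xs walk) _ _

module Structure {n} (G : Graph n) (noISK4 : ¬ HasISK4 G) (noK₃ : ¬ Contains G (K 3)) (k33 : Contains G K33)
  where

  open Adjacency G
  open Subdivision G

  triangle-free : ∀ {x y z} → x ~ y → y ~ z → x ~ z → ⊥
  triangle-free = no-triangle noK₃

  -- Sides of the K₃,₃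

  corner : Bool → Fin 3 → Fin n
  corner σ i = proj₁ k33 (side σ i)

  corner-across : ∀ σ i j → corner σ i ~ corner (not σ) j
  corner-across σ i j = trans (sym (proj₂ (proj₂ k33) _ _)) (K33-across σ i j)

  corner-within : ∀ σ i j → ¬ corner σ i ~ corner σ j
  corner-within σ i j = ≡false⇒≢true (trans (sym (proj₂ (proj₂ k33) _ _)) (K33-within σ i j))

  corner-injective : ∀ σ → Injective _≡_ _≡_ (corner σ)
  corner-injective σ = side-injective σ ∘ proj₁ (proj₂ k33)

  corner-distinct : ∀ σ {i j} → i ≢ j → corner σ i ≢ corner σ j
  corner-distinct σ i≢j = i≢j ∘ corner-injective σ

  record OnSide (σ : Bool) (x : Fin n) : Set where
    constructor onSide
    field sees : ∀ i → x ~ corner (not σ) i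
  open OnSide

  onSide? : ∀ σ x → Dec (OnSide σ x)
  onSide? σ x = map′ onSide sees (all? λ i → x ~? corner (not σ) i)

  corner-onSide : ∀ σ i → OnSide σ (corner σ i)
  corner-onSide σ i = onSide (corner-across σ i)

  onSide-sees : ∀ σ {x} → OnSide (not σ) x → ∀ i → x ~ corner σ i
  onSide-sees σ {x} h i = subst (λ τ → x ~ corner τ i) (not-involutive σ) (sees h i)

  sees⇒onSide : ∀ σ {x} → (∀ i → x ~ corner σ i) → OnSide (not σ) x
  sees⇒onSide σ {x} h = onSide λ i → subst (λ τ → x ~ corner τ i) (sym (not-involutive σ)) (h i)

  onSide-independent : ∀ {σ x y} → OnSide σ x → OnSide σ y → ¬ x ~ y
  onSide-independent hx hy x~y = triangle-free x~y (sees hy 0F) (sees hx 0F)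

  onSide-disjoint : ∀ σ {x} → OnSide σ x → ¬ OnSide (not σ) x
  onSide-disjoint σ hx hx′ = triangle-free (onSide-sees σ hx′ 0F) (corner-across σ 0F 0F) (sees hx 0F)

  onSide-≢ : ∀ σ {x y} → OnSide σ x → OnSide (not σ) y → x ≢ y
  onSide-≢ σ hx hy refl = onSide-disjoint σ hx hy

  -- A missing edge xy yields an ISK4: the path u y v together with x, b₁, b₂.
  onSide-complete : ∀ σ {x y} → OnSide σ x → OnSide (not σ) y → x ~ y
  onSide-complete σ {x} {y} hx hy with x ~? y
  ... | yes x~y = x~y
  ... | no x≁y  = ⊥-elim (noISK4 (isk4 (y ∷ []) (~-sym (y-sees 0F) , y-sees 1F) chordless unique avoids))
    where
    u  = corner σ 0F
    v  = corner σ 1F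
    b₁ = corner (not σ) 0F
    b₂ = corner (not σ) 1F
    y-sees = onSide-sees σ hy
    frame : Frame x u v b₁ b₂
    frame = record
      { u~b₁ = corner-across σ 0F 0F ; u~b₂ = corner-across σ 0F 1F
      ; v~b₁ = corner-across σ 1F 0F ; v~b₂ = corner-across σ 1F 1F
      ; a~b₁ = sees hx 0F            ; a~b₂ = sees hx 1F
      ; a≁u  = λ x~u → triangle-free x~u (corner-across σ 0F 0F) (sees hx 0F)
      ; a≁v  = λ x~v → triangle-free x~v (corner-across σ 1F 0F) (sees hx 0F)
      ; b₁≁b₂ = corner-within (not σ) 0F 1F
      }
    open FramedPath frame
    chordless : Chordless (u ∷ y ∷ v ∷ [])
    chordless = (corner-within σ 0F 1F ∷ []) , [] , [] , tt
    y≢b : ∀ i → y ≢ corner (not σ) i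
    y≢b i y≡b = x≁y (subst (x ~_) (sym y≡b) (sees hx i))
    x≢a : ∀ i → x ≢ corner σ i
    x≢a i x≡a = x≁y (subst (_~ y) (sym x≡a) (~-sym (y-sees i)))
    unique : Unique (y ∷ T)
    unique = (onSide-≢ σ hx hy ∘ sym ∷ ~⇒≢ (y-sees 0F) ∷ ~⇒≢ (y-sees 1F) ∷ y≢b 0F ∷ y≢b 1F ∷ [])
           ∷ (x≢a 0F ∷ x≢a 1F ∷ ~⇒≢ (sees hx 0F) ∷ ~⇒≢ (sees hx 1F) ∷ [])
           ∷ (corner-distinct σ (λ ()) ∷ ~⇒≢ (corner-across σ 0F 0F) ∷ ~⇒≢ (corner-across σ 0F 1F) ∷ [])
           ∷ (~⇒≢ (corner-across σ 1F 0F) ∷ ~⇒≢ (corner-across σ 1F 1F) ∷ [])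
           ∷ (corner-distinct (not σ) (λ ()) ∷ [])
           ∷ [] ∷ []
    avoids : All Avoids (y ∷ [])
    avoids = (x≁y ∘ ~-sym
             , triangle-free (y-sees 0F) (corner-across σ 0F 0F)
             , triangle-free (y-sees 0F) (corner-across σ 0F 1F)) ∷ []

  Outside : Fin n → Set
  Outside x = ¬ OnSide true x × ¬ OnSide false x

  outside? : ∀ x → Dec (Outside x)
  outside? x = ¬? (onSide? true x) ×-dec ¬? (onSide? false x)

  outside-¬onSide : ∀ σ {x} → Outside x → ¬ OnSide σ x
  outside-¬onSide true  = proj₁
  outside-¬onSide false = proj₂

  outside-≢ : ∀ {σ x y} → Outside x → OnSide σ y → x ≢ y
  outside-≢ {σ} out hy refl = outside-¬onSide σ out hy

  ¬outside⇒onSide : ∀ {x} → ¬ Outside x → ∃ λ σ → OnSide σ x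
  ¬outside⇒onSide {x} ¬out with onSide? true x | onSide? false x
  ... | yes h | _     = true , h
  ... | no _  | yes h = false , h
  ... | no h  | no h′ = ⊥-elim (¬out (h , h′))

  missing-corner : ∀ σ {x} → Outside x → ∃ λ i → ¬ x ~ corner σ i
  missing-corner σ {x} out = ¬∀⟶∃¬ 3 _ (λ i → x ~? corner σ i) (outside-¬onSide (not σ) out ∘ sees⇒onSide σ)

  corner-avoiding : ∀ σ a b → ∃ λ i → corner σ i ≢ a × corner σ i ≢ b
  corner-avoiding σ a b with two-missing (λ i → corner σ i ≟ a) (λ p q → corner-injective σ (trans p (sym q)))
  ... | i , j , i≢j , i≢a , j≢a with corner σ i ≟ b
  ...   | no i≢b  = i , i≢a , i≢b
  ...   | yes i≡b = j , j≢a , λ j≡b → i≢j (corner-injective σ (trans i≡b (sym j≡b)))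

  -- Minimal bridges

  record Bridge (σ : Bool) (u v : Fin n) (ps : List (Fin n)) : Set where
    field
      u-onSide : OnSide σ u
      v-onSide : OnSide σ v
      u≢v      : u ≢ v
      walk     : Walk u ps v
      interior : All Outside ps

  NoBridgeBelow : ℕ → Set
  NoBridgeBelow k = ∀ {σ u v ps} → length ps < k → Bridge σ u v ps → ⊥

  no-shorter-bridge : ∀ {k τ a b} qs → NoBridgeBelow k → length qs < k →
            OnSide τ a → OnSide τ b → a ≢ b → Walk a qs b → All Outside qs → ⊥
  no-shorter-bridge _ minimal lt ha hb a≢b w o =
    minimal lt (record { u-onSide = ha ; v-onSide = hb ; u≢v = a≢b ; walk = w ; interior = o })

  start-chordless : ∀ {σ u v ps} → Bridge σ u v ps → NoBridgeBelow (length ps) →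
                    All (λ y → ¬ u ~ y) (drop 1 (ps ++ v ∷ []))
  start-chordless {ps = []}              _ _       = []
  start-chordless {u = u} {v} {p ∷ rest} b minimal = All.tabulate chord
    where
    open Bridge b
    chord : ∀ {y} → y ∈ rest ++ v ∷ [] → ¬ u ~ y
    chord y∈ with ∈-++⁻ rest y∈
    ... | inj₂ (here refl) = onSide-independent u-onSide v-onSide
    ... | inj₁ y∈rest with ∈-∃++ y∈rest
    ...   | m , post , refl = λ u~y →
      no-shorter-bridge (_ ∷ post) minimal (length-<-∷-++ p m _) u-onSide v-onSide u≢v
        (u~y , proj₂ (walk-split (p ∷ m) post walk)) (Allₚ.++⁻ʳ (p ∷ m) interior)

  chord-after : ∀ {σ u v ps} → Bridge σ u v ps → NoBridgeBelow (length ps) →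
                ∀ pre x s → ps ≡ pre ++ x ∷ s → All (λ y → ¬ x ~ y × x ≢ y) (drop 1 (s ++ v ∷ []))
  chord-after _ _ _ _ [] _ = []
  chord-after {u = u} {v} b minimal pre x (s₀ ∷ s) refl = All.tabulate chord
    where
    open Bridge b
    before : Walk u pre x
    before = proj₁ (walk-split pre (s₀ ∷ s) walk)
    after : Walk s₀ s v
    after = proj₂ (proj₂ (walk-split pre (s₀ ∷ s) walk))
    x-outside : Outside x
    x-outside = All.head (Allₚ.++⁻ʳ pre interior)
    chord : ∀ {y} → y ∈ s ++ v ∷ [] → ¬ x ~ y × x ≢ y
    chord y∈ with ∈-++⁻ s y∈
    ... | inj₂ (here refl) =
      (λ x~v → no-shorter-bridge (pre ++ x ∷ []) minimal (length-++-< pre (s≤s (s≤s z≤n))) u-onSide v-onSide u≢v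
                 (walk-join pre [] before x~v) (All-upto pre interior))
      , outside-≢ x-outside v-onSide
    ... | inj₁ y∈s with ∈-∃++ y∈s
    ...   | m , post , refl =
      (λ x~y → no-shorter-bridge (pre ++ x ∷ _ ∷ post) minimal (length-++-< pre (s≤s (length-<-∷-++ s₀ m _)))
                 u-onSide v-onSide u≢v (walk-join pre (_ ∷ post) before (x~y , y-to-v))
                 (All-skip pre (s₀ ∷ m) interior))
      , (λ x≡y → no-shorter-bridge (pre ++ _ ∷ post) minimal (length-++-< pre (length-<-∷-++ x (s₀ ∷ m) _))
                 u-onSide v-onSide u≢v (walk-join pre post (subst (Walk u pre) x≡y before) y-to-v)
                 (All-delete pre (x ∷ s₀ ∷ m) interior))
      where
      y-to-v = proj₂ (walk-split m post after)

  suffix-chordless : ∀ {σ u v ps} → Bridge σ u v ps → NoBridgeBelow (length ps) →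
                     ∀ pre s → ps ≡ pre ++ s → Chordless (s ++ v ∷ [])
  suffix-chordless _ _ _ [] _ = [] , tt
  suffix-chordless b minimal pre (x ∷ s) eq =
    All.map proj₁ (chord-after b minimal pre x s eq) ,
    suffix-chordless b minimal (pre ++ x ∷ []) s (trans eq (sym (++-assoc pre (x ∷ []) s)))

  suffix-unique : ∀ {σ u v ps} → Bridge σ u v ps → NoBridgeBelow (length ps) →
                  ∀ pre s → ps ≡ pre ++ s → Unique s
  suffix-unique _ _ _ [] _ = []
  suffix-unique _ _ _ (_ ∷ []) _ = [] ∷ []
  suffix-unique b minimal pre (x ∷ s₀ ∷ s) refl =
    (~⇒≢ x~s₀ ∷ Allₚ.++⁻ˡ s (All.map proj₂ (chord-after b minimal pre x (s₀ ∷ s) refl)))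
    ∷ suffix-unique b minimal (pre ++ x ∷ []) (s₀ ∷ s) (sym (++-assoc pre (x ∷ []) (s₀ ∷ s)))
    where
    x~s₀ = proj₁ (proj₂ (walk-split pre (s₀ ∷ s) (Bridge.walk b)))

  third-contact : ∀ {σ u v ps} → Bridge σ u v ps → NoBridgeBelow (length ps) →
                  ∀ {a} → OnSide σ a → a ≢ u → a ≢ v →
                  ∀ pre x post → ps ≡ pre ++ x ∷ post → x ~ a → pre ≡ [] × post ≡ []
  third-contact b minimal ha a≢u _ pre x (q ∷ post) refl x~a =
    ⊥-elim (no-shorter-bridge (pre ++ x ∷ []) minimal (length-++-< pre (s≤s (s≤s z≤n))) u-onSide ha (a≢u ∘ sym)
              (walk-join pre [] (proj₁ (walk-split pre (q ∷ post) walk)) x~a) (All-upto pre interior))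
    where open Bridge b
  third-contact b minimal ha _ a≢v (p ∷ pre) x [] refl x~a =
    ⊥-elim (no-shorter-bridge (x ∷ []) minimal (length-<-∷-++ p pre (x ∷ [])) ha v-onSide a≢v
              (~-sym x~a , proj₂ (walk-split (p ∷ pre) [] walk)) (All.head (Allₚ.++⁻ʳ (p ∷ pre) interior) ∷ []))
    where open Bridge b
  third-contact _ _ _ _ _ [] _ [] refl _ = refl , refl

  third-corner : ∀ {σ u v ps} → Bridge σ u v ps → NoBridgeBelow (length ps) →
                 ∃ λ a → OnSide σ a × a ≢ u × a ≢ v × All (λ x → ¬ x ~ a) ps
  third-corner {ps = []} b _ = ⊥-elim (onSide-independent u-onSide v-onSide walk)
    where open Bridge b
  third-corner {σ} {ps = x ∷ []} b _ with missing-corner σ (All.head (Bridge.interior b))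
  ... | i , x≁a = corner σ i , corner-onSide σ i ,
                  (λ a≡u → x≁a (subst (x ~_) (sym a≡u) (~-sym (proj₁ (Bridge.walk b))))) ,
                  (λ a≡v → x≁a (subst (x ~_) (sym a≡v) (proj₂ (Bridge.walk b)))) , x≁a ∷ []
  third-corner {σ} {u} {v} {ps@(_ ∷ _ ∷ _)} b minimal with corner-avoiding σ u v
  ... | i , a≢u , a≢v = corner σ i , corner-onSide σ i , a≢u , a≢v , All.tabulate far
    where
    far : ∀ {x} → x ∈ ps → ¬ x ~ corner σ i
    far x∈ x~a with ∈-∃++ x∈
    ... | pre , post , eq with third-contact b minimal (corner-onSide σ i) a≢u a≢v pre _ post eq x~a
    ...   | refl , refl with eq
    ...     | ()

  contacts-segment : ∀ {σ u v ps} → Bridge σ u v ps → NoBridgeBelow (length ps) →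
                     ∀ {b b′} → OnSide (not σ) b → OnSide (not σ) b′ → b ≢ b′ →
                     ∀ p₁ x m y p₃ → ps ≡ p₁ ++ x ∷ m ++ y ∷ p₃ → x ~ b → y ~ b′ → ⊥
  contacts-segment {σ} br _ hb _ _ [] x m y p₃ refl x~b _ =
    triangle-free (proj₁ (Bridge.walk br)) x~b (onSide-complete σ (Bridge.u-onSide br) hb)
  contacts-segment {σ} br _ _ hb′ _ (q ∷ p₁) x m y [] refl _ y~b′ =
    triangle-free (~-sym y~v) y~b′ (onSide-complete σ (Bridge.v-onSide br) hb′)
    where
    y~v = proj₂ (walk-split m [] (proj₂ (walk-split (q ∷ p₁) (m ++ y ∷ []) (Bridge.walk br))))
  contacts-segment br minimal hb hb′ b≢b′ (q ∷ p₁) x m y (r ∷ p₃) refl x~b y~b′ =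
    no-shorter-bridge (x ∷ m ++ y ∷ []) minimal
      (<-trans (length-++-< (x ∷ m) (s≤s (s≤s z≤n))) (length-<-∷-++ q p₁ _))
      hb hb′ b≢b′ (~-sym x~b , walk-join m [] (proj₁ (walk-split m (r ∷ p₃) from-x)) y~b′)
      (All-upto (x ∷ m) (Allₚ.++⁻ʳ (q ∷ p₁) (Bridge.interior br)))
    where
    from-x = proj₂ (walk-split (q ∷ p₁) (m ++ y ∷ r ∷ p₃) (Bridge.walk br))

  contacts-vertex : ∀ {σ u v ps} → Bridge σ u v ps → NoBridgeBelow (length ps) →
                    ∀ {b b′} → OnSide (not σ) b → OnSide (not σ) b′ → b ≢ b′ →
                    ∀ p₁ x p₂ → ps ≡ p₁ ++ x ∷ p₂ → x ~ b → x ~ b′ → ⊥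
  contacts-vertex {σ} br _ hb _ _ [] x p₂ refl x~b _ =
    triangle-free (proj₁ (Bridge.walk br)) x~b (onSide-complete σ (Bridge.u-onSide br) hb)
  contacts-vertex {σ} br _ hb _ _ (q ∷ p₁) x [] refl x~b _ =
    triangle-free (~-sym (proj₂ (walk-split (q ∷ p₁) [] (Bridge.walk br)))) x~b
      (onSide-complete σ (Bridge.v-onSide br) hb)
  contacts-vertex br minimal hb hb′ b≢b′ (q ∷ p₁) x (r ∷ p₂) refl x~b x~b′ =
    no-shorter-bridge (x ∷ []) minimal (<-trans (s≤s (s≤s z≤n)) (length-<-∷-++ q p₁ (x ∷ r ∷ p₂))) hb hb′ b≢b′
      (~-sym x~b , x~b′) (All.head (Allₚ.++⁻ʳ (q ∷ p₁) (Bridge.interior br)) ∷ [])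

  opposite-contacts : ∀ {σ u v ps} → Bridge σ u v ps → NoBridgeBelow (length ps) →
                      ∀ {b b′} → OnSide (not σ) b → OnSide (not σ) b′ → b ≢ b′ →
                      ∀ {x y} → x ∈ ps → y ∈ ps → x ~ b → y ~ b′ → ⊥
  opposite-contacts br minimal hb hb′ b≢b′ x∈ y∈ x~b y~b′ with ∈-∃++ x∈
  ... | p₁ , p₂ , refl with ∈-++⁻ p₁ y∈
  ...   | inj₂ (here refl) = contacts-vertex br minimal hb hb′ b≢b′ p₁ _ p₂ refl x~b y~b′
  ...   | inj₂ (there y∈p₂) with ∈-∃++ y∈p₂
  ...     | m , p₃ , refl = contacts-segment br minimal hb hb′ b≢b′ p₁ _ m _ p₃ refl x~b y~b′
  opposite-contacts br minimal hb hb′ b≢b′ x∈ y∈ x~b y~b′ | p₁ , p₂ , refl | inj₁ y∈p₁ with ∈-∃++ y∈p₁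
  ...     | q₁ , q₂ , refl =
    contacts-segment br minimal hb′ hb (b≢b′ ∘ sym) q₁ _ q₂ _ p₂ (++-assoc q₁ (_ ∷ q₂) (_ ∷ p₂)) y~b′ x~b

  far-opposite-corners : ∀ {σ u v ps} → Bridge σ u v ps → NoBridgeBelow (length ps) →
                         ∃₂ λ i j → i ≢ j × All (λ x → ¬ x ~ corner (not σ) i) ps
                                          × All (λ x → ¬ x ~ corner (not σ) j) ps
  far-opposite-corners {σ} {ps = ps} br minimal
    with two-missing (λ i → Any.any? (_~? corner (not σ) i) ps) at-most-one
    where
    at-most-one : ∀ {i j} → Any.Any (_~ corner (not σ) i) ps → Any.Any (_~ corner (not σ) j) ps → i ≡ j
    at-most-one {i} {j} touch-i touch-j with i ≟ j | find touch-i | find touch-j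
    ... | yes i≡j | _ | _ = i≡j
    ... | no i≢j | x , x∈ , x~b | y , y∈ , y~b′ =
      ⊥-elim (opposite-contacts br minimal (corner-onSide (not σ) i) (corner-onSide (not σ) j)
                (corner-distinct (not σ) i≢j) x∈ y∈ x~b y~b′)
  ... | i , j , i≢j , ¬touch-i , ¬touch-j =
    i , j , i≢j , Allₚ.¬Any⇒All¬ ps ¬touch-i , Allₚ.¬Any⇒All¬ ps ¬touch-j

  minimal-bridge-impossible : ∀ {σ u v ps} → Bridge σ u v ps → NoBridgeBelow (length ps) → ⊥
  minimal-bridge-impossible {σ} {u} {v} {ps} br minimal
    with third-corner br minimal | far-opposite-corners br minimal
  ... | a , ha , a≢u , a≢v , a-far | i , j , i≢j , i-far , j-far =
    noISK4 (isk4 ps walk (start-chordless br minimal , suffix-chordless br minimal [] ps refl) unique avoids)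
    where
    open Bridge br
    hb₁ = corner-onSide (not σ) i
    hb₂ = corner-onSide (not σ) j
    frame : Frame a u v (corner (not σ) i) (corner (not σ) j)
    frame = record
      { u~b₁ = onSide-complete σ u-onSide hb₁ ; u~b₂ = onSide-complete σ u-onSide hb₂
      ; v~b₁ = onSide-complete σ v-onSide hb₁ ; v~b₂ = onSide-complete σ v-onSide hb₂
      ; a~b₁ = onSide-complete σ ha hb₁       ; a~b₂ = onSide-complete σ ha hb₂
      ; a≁u  = onSide-independent ha u-onSide
      ; a≁v  = onSide-independent ha v-onSide
      ; b₁≁b₂ = corner-within (not σ) i j
      }
    open FramedPath frame
    T-unique : Unique T
    T-unique = (a≢u ∷ a≢v ∷ onSide-≢ σ ha hb₁ ∷ onSide-≢ σ ha hb₂ ∷ [])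
             ∷ (u≢v ∷ onSide-≢ σ u-onSide hb₁ ∷ onSide-≢ σ u-onSide hb₂ ∷ [])
             ∷ (onSide-≢ σ v-onSide hb₁ ∷ onSide-≢ σ v-onSide hb₂ ∷ [])
             ∷ (corner-distinct (not σ) i≢j ∷ [])
             ∷ [] ∷ []
    T-onSide : ∀ {y} → y ∈ T → ∃ λ τ → OnSide τ y
    T-onSide (here refl)                                 = σ , ha
    T-onSide (there (here refl))                         = σ , u-onSide
    T-onSide (there (there (here refl)))                 = σ , v-onSide
    T-onSide (there (there (there (here refl))))         = not σ , hb₁
    T-onSide (there (there (there (there (here refl))))) = not σ , hb₂
    disjoint : ∀ {y} → ¬ (y ∈ ps × y ∈ T)
    disjoint (y∈ps , y∈T) = outside-≢ (All.lookup interior y∈ps) (proj₂ (T-onSide y∈T)) refl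
    unique : Unique (ps ++ T)
    unique = Uniqueₚ.++⁺ (suffix-unique br minimal [] ps refl) T-unique disjoint
    avoids : All Avoids ps
    avoids = All.tabulate λ x∈ → All.lookup a-far x∈ , All.lookup i-far x∈ , All.lookup j-far x∈

  no-bridge-below : ∀ k → NoBridgeBelow k
  no-bridge-below (suc k) lt br =
    minimal-bridge-impossible br λ lt′ → no-bridge-below k (<-≤-trans lt′ (≤-pred lt))

  no-bridge : ∀ {σ u v ps} → ¬ Bridge σ u v ps
  no-bridge {ps = ps} = no-bridge-below (suc (length ps)) (n<1+n (length ps))

  -- The component of an outside vertex

  data OutsideWalk : Fin n → Fin n → Set where
    stop : ∀ {a} → Outside a → OutsideWalk a a
    move : ∀ {a b c} → Outside a → a ~ b → OutsideWalk b c → OutsideWalk a c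

  snocʷ : ∀ {a b c} → OutsideWalk a b → b ~ c → Outside c → OutsideWalk a c
  snocʷ (stop a-out)       a~c c-out = move a-out a~c (stop c-out)
  snocʷ (move a-out a~b w) b~c c-out = move a-out a~b (snocʷ w b~c c-out)

  reverseʷ : ∀ {a b} → OutsideWalk a b → OutsideWalk b a
  reverseʷ (stop a-out)       = stop a-out
  reverseʷ (move a-out a~b w) = snocʷ (reverseʷ w) (~-sym a~b) a-out

  _++ʷ_ : ∀ {a b c} → OutsideWalk a b → OutsideWalk b c → OutsideWalk a c
  stop _             ++ʷ w′ = w′
  move a-out a~b w   ++ʷ w′ = move a-out a~b (w ++ʷ w′)

  start-outside : ∀ {a b} → OutsideWalk a b → Outside a
  start-outside (stop a-out)     = a-out
  start-outside (move a-out _ _) = a-out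

  vertices : ∀ {a b} → OutsideWalk a b → List (Fin n)
  vertices (stop {a} _)     = a ∷ []
  vertices (move {a} _ _ w) = a ∷ vertices w

  vertices-outside : ∀ {a b} (w : OutsideWalk a b) → All Outside (vertices w)
  vertices-outside (stop a-out)     = a-out ∷ []
  vertices-outside (move a-out _ w) = a-out ∷ vertices-outside w

  vertices-walk : ∀ {c d a b} → c ~ a → (w : OutsideWalk a b) → b ~ d → Walk c (vertices w) d
  vertices-walk c~a (stop _)       b~d = c~a , b~d
  vertices-walk c~a (move _ a~b w) b~d = c~a , vertices-walk a~b w b~d

  start-∉ : ∀ {C : Subset n} {a c} → ReachAvoid G C a c → a ∉ₛ C
  start-∉ (here a∉C)     = a∉C
  start-∉ (next a∉C _ _) = a∉C

  module Component (w : Fin n) (w-outside : Outside w) where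

    Reaches : Subset n → Set
    Reaches R = ∀ {y} → y ∈ₛ R → OutsideWalk y w

    Closed : Subset n → Set
    Closed R = ∀ {y x} → y ∈ₛ R → Outside x → y ~ x → x ∈ₛ R

    Frontier : Subset n → Fin n → Set
    Frontier R x = x ∉ₛ R × Outside x × ∃ λ y → y ∈ₛ R × y ~ x

    frontier? : ∀ R → Decidable (Frontier R)
    frontier? R x = ¬? (x ∈? R) ×-dec outside? x ×-dec any? λ y → (y ∈? R) ×-dec (y ~? x)

    grow    : ∀ k R → n ≤ k + ∣ R ∣ → Reaches R → ∃ λ R′ → R ⊆ R′ × Reaches R′ × Closed R′
    grow-by : ∀ k R {x} → Frontier R x → n ≤ k + ∣ R ∣ → Reaches R → ∃ λ R′ → R ⊆ R′ × Reaches R′ × Closed R′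

    grow k R bound reaches with any? (frontier? R)
    ... | yes (_ , frontier) = grow-by k R frontier bound reaches
    ... | no none = R , id , reaches , λ {y} {x} y∈R x-out y~x →
      decidable-stable (x ∈? R) λ x∉R → none (x , x∉R , x-out , y , y∈R , y~x)

    grow-by zero    R {x} (x∉R , _) bound _ =
      ⊥-elim (<-irrefl refl (≤-<-trans bound (<-≤-trans (∣p∣<∣p∪⁅x⁆∣ x∉R) (∣p∣≤n (R ∪ ⁅ x ⁆)))))
    grow-by (suc k) R {x} (x∉R , x-out , y , y∈R , y~x) bound reaches =
      let (R′ , ⊆R′ , reaches′ , closed′) = grow k (R ∪ ⁅ x ⁆) bound′ reaches-x
      in R′ , ⊆R′ ∘ p⊆p∪q ⁅ x ⁆ , reaches′ , closed′
      where
      bound′ : n ≤ k + ∣ R ∪ ⁅ x ⁆ ∣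
      bound′ = ≤-trans bound (≤-trans (≤-reflexive (sym (+-suc k ∣ R ∣))) (+-monoʳ-≤ k (∣p∣<∣p∪⁅x⁆∣ x∉R)))
      reaches-x : Reaches (R ∪ ⁅ x ⁆)
      reaches-x z∈ with x∈p∪q⁻ R ⁅ x ⁆ z∈
      ... | inj₁ z∈R = reaches z∈R
      ... | inj₂ z∈x with x∈⁅y⁆⇒x≡y x z∈x
      ...   | refl = move x-out (~-sym y~x) (reaches y∈R)

    component : ∃ λ R → w ∈ₛ R × Reaches R × Closed R
    component with grow n ⁅ w ⁆ (m≤m+n n ∣ ⁅ w ⁆ ∣) reaches-w
      where
      reaches-w : Reaches ⁅ w ⁆
      reaches-w y∈ with x∈⁅y⁆⇒x≡y w y∈
      ... | refl = stop w-outside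
    ... | R , ⊆R , reaches , closed = R , ⊆R (x∈⁅x⁆ w) , reaches , closed

    R : Subset n
    R = proj₁ component

    w∈R : w ∈ₛ R
    w∈R = proj₁ (proj₂ component)

    reaches : Reaches R
    reaches = proj₁ (proj₂ (proj₂ component))

    closed : Closed R
    closed = proj₂ (proj₂ (proj₂ component))

    Attached : Bool → Fin n → Set
    Attached σ z = OnSide σ z × ∃ λ y → y ∈ₛ R × y ~ z

    attached? : ∀ σ → Decidable (Attached σ)
    attached? σ z = onSide? σ z ×-dec any? λ y → (y ∈? R) ×-dec (y ~? z)

    attachments : Bool → Subset n
    attachments σ = subset (attached? σ)

    C : Subset n
    C = attachments true ∪ attachments false

    ∈C⁺ : ∀ σ {z} → Attached σ z → z ∈ₛ C
    ∈C⁺ true  att = x∈p∪q⁺ (inj₁ (∈-subset⁺ (attached? true) att))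
    ∈C⁺ false att = x∈p∪q⁺ (inj₂ (∈-subset⁺ (attached? false) att))

    ∈C⁻ : ∀ {z} → z ∈ₛ C → ∃ λ σ → Attached σ z
    ∈C⁻ z∈ with x∈p∪q⁻ (attachments true) (attachments false) z∈
    ... | inj₁ z∈t = true , ∈-subset⁻ (attached? true) z∈t
    ... | inj₂ z∈f = false , ∈-subset⁻ (attached? false) z∈f

    -- Two attachments on one side would be joined by a bridge through R.
    attached-unique : ∀ σ {z z′} → Attached σ z → Attached σ z′ → z ≡ z′
    attached-unique σ {z} {z′} (hz , y , y∈R , y~z) (hz′ , y′ , y′∈R , y′~z′) with z ≟ z′
    ... | yes z≡z′ = z≡z′
    ... | no z≢z′  = ⊥-elim (no-bridge (record
      { u-onSide = hz ; v-onSide = hz′ ; u≢v = z≢z′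
      ; walk = vertices-walk (~-sym y~z) joined y′~z′ ; interior = vertices-outside joined }))
      where
      joined = reaches y∈R ++ʷ reverseʷ (reaches y′∈R)

    C-clique : IsClique G C
    C-clique x y x∈ y∈ x≢y with ∈C⁻ x∈ | ∈C⁻ y∈
    ... | true  , ax       | true  , ay       = ⊥-elim (x≢y (attached-unique true ax ay))
    ... | true  , (hx , _) | false , (hy , _) = onSide-complete true hx hy
    ... | false , (hx , _) | true  , (hy , _) = onSide-complete false hx hy
    ... | false , ax       | false , ay       = ⊥-elim (x≢y (attached-unique false ax ay))

    C-size : ∣ C ∣ ≤ 2
    C-size = ≤-trans (∣p∪q∣≤∣p∣+∣q∣ (attachments true) (attachments false))
                     (+-mono-≤ (at-most-one true) (at-most-one false))
      where
      at-most-one : ∀ σ → ∣ attachments σ ∣ ≤ 1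
      at-most-one σ = ∣p∣≤1 (attachments σ) λ x∈ y∈ →
        attached-unique σ (∈-subset⁻ (attached? σ) x∈) (∈-subset⁻ (attached? σ) y∈)

    trapped : ∀ {y c} → y ∈ₛ R → ReachAvoid G C y c → Outside c
    trapped y∈R (here _) = start-outside (reaches y∈R)
    trapped y∈R (next {b = b} _ y~b rest) with outside? b
    ... | yes b-out = trapped (closed y∈R b-out y~b) rest
    ... | no b-in   = let (σ , hb) = ¬outside⇒onSide b-in in ⊥-elim (start-∉ rest (∈C⁺ σ (hb , _ , y∈R , y~b)))

    unattached-corner-∉C : ∀ i → corner true i ∉ₛ attachments true → corner true i ∉ₛ C
    unattached-corner-∉C i ∉t ∈C with x∈p∪q⁻ (attachments true) (attachments false) ∈C
    ... | inj₁ ∈t = ∉t ∈t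
    ... | inj₂ ∈f = onSide-disjoint true (corner-onSide true i) (proj₁ (∈-subset⁻ (attached? false) ∈f))

    corner-∉C : ∃ λ i → corner true i ∉ₛ C
    corner-∉C with corner true 0F ∈? attachments true
    ... | no ∉t  = 0F , unattached-corner-∉C 0F ∉t
    ... | yes ∈t = 1F , unattached-corner-∉C 1F λ ∈t′ →
      0≢1+n (corner-injective true
               (attached-unique true (∈-subset⁻ (attached? true) ∈t) (∈-subset⁻ (attached? true) ∈t′)))

    C-disconnects : Disconnects G C
    C-disconnects = w , corner true i , w∉C , corner∉C ,
                    λ reach → outside-¬onSide true (trapped w∈R reach) (corner-onSide true i)
      where
      i = proj₁ corner-∉C
      corner∉C = proj₂ corner-∉C
      w∉C : w ∉ₛ C
      w∉C w∈ = let (σ , hw , _) = ∈C⁻ w∈ in outside-¬onSide σ w-outside hw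

  complete-bipartite : (∀ x → ¬ Outside x) → IsCompleteBipartite G
  complete-bipartite all-on-side =
    colour , λ x y → adjacency (¬outside⇒onSide (all-on-side x)) (¬outside⇒onSide (all-on-side y))
    where
    colour : Fin n → Bool
    colour x = does (onSide? true x)
    colour-onSide : ∀ σ {x} → OnSide σ x → colour x ≡ σ
    colour-onSide true  h = dec-true (onSide? true _) h
    colour-onSide false h = dec-false (onSide? true _) (onSide-disjoint false h)
    side-adjacency : ∀ σ τ {x y} → OnSide σ x → OnSide τ y → adj G x y ≡ (σ xor τ)
    side-adjacency true  true  hx hy = ≢true⇒≡false (onSide-independent hx hy)
    side-adjacency true  false hx hy = onSide-complete true hx hy
    side-adjacency false true  hx hy = onSide-complete false hx hy
    side-adjacency false false hx hy = ≢true⇒≡false (onSide-independent hx hy)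
    adjacency : ∀ {x y} → (∃ λ σ → OnSide σ x) → (∃ λ τ → OnSide τ y) → adj G x y ≡ (colour x xor colour y)
    adjacency (σ , hx) (τ , hy) =
      trans (side-adjacency σ τ hx hy) (sym (cong₂ _xor_ (colour-onSide σ hx) (colour-onSide τ hy)))

lemma2p6 : ∀ {n} (G : Graph n) → ¬ HasISK4 G → ¬ Contains G (K 3) →
    Contains G K33 → IsCompleteBipartite G ⊎ HasCliqueCutset≤2 G
lemma2p6 G noISK4 noK₃ k33 = dichotomy
  where
  open Structure G noISK4 noK₃ k33
  dichotomy : IsCompleteBipartite G ⊎ HasCliqueCutset≤2 G
  dichotomy with any? outside?
  ... | no none              = inj₁ (complete-bipartite λ x out → none (x , out))
  ... | yes (w , w-outside) = inj₂ (C , C-clique , C-disconnects , C-size)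
    where open Component w w-outside
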